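{- For every phinary number $p$ and every positive integer $n$, the number $\phi^n p$ is a phinary number.
   Context: Let $\phi=\frac{1+\sqrt5}{2}$ and $\psi=1/\phi$. The Fibonacci words over $\{A,B\}$ are $w_1=A$, $w_2=AB$, $w_{n+2}=w_{n+1}w_n$; the infinite Fibonacci word $c_1c_2c_3\cdots=ABAABABAAB\cdots$ is their common extension. With $v(A)=1$, $v(B)=\psi$, set $p_0=0$, $p_m=\sum_{i=1}^m v(c_i)$. The phinary numbers are the elements of $\mathbb{Z}^+_\Phi=\{p_m: m\ge1\}$. -}

module Defs where

open import Data.Nat using (ℕ; zero; suc; _≤_)
open import Data.Integer using (ℤ; +_; -[1+_]) renaming (_+_ to _+ℤ_; _*_ to _*ℤ_)
open import Data.List using (List; []; _∷_; _++_)
open import Data.Product using (Σ; _×_; _,_; ∃-syntax)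
open import Relation.Binary.PropositionalEquality using (_≡_)

-- Elements a + bφ of ℤ[φ] ⊂ ℝ, represented by the pair (a , b).
-- Since φ is irrational, this representation is unique, so _≡_ on
-- pairs is equality of the corresponding real numbers.
record ℤφ : Set where
  constructor _+_φ
  field
    re : ℤ
    im : ℤ
open ℤφ public

infixl 6 _⊕_
infixl 7 _⊗_

_⊕_ : ℤφ → ℤφ → ℤφ
(a + b φ) ⊕ (c + d φ) = (a +ℤ c) + (b +ℤ d) φ

-- uses φ² = φ + 1
_⊗_ : ℤφ → ℤφ → ℤφ
(a + b φ) ⊗ (c + d φ) = ((a *ℤ c) +ℤ (b *ℤ d)) + ((a *ℤ d) +ℤ (b *ℤ c) +ℤ (b *ℤ d)) φ

zeroφ oneφ φ ψ : ℤφ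
zeroφ = (+ 0) + (+ 0) φ
oneφ  = (+ 1) + (+ 0) φ
φ     = (+ 0) + (+ 1) φ
-- ψ = 1/φ = φ - 1
ψ     = -[1+ 0 ] + (+ 1) φ

φ^ : ℕ → ℤφ
φ^ zero    = oneφ
φ^ (suc n) = φ ⊗ φ^ n

data Letter : Set where
  A B : Letter

-- Fibonacci words: fibWord k = w_(k+1), i.e. w₁ = A, w₂ = AB, w_(n+2) = w_(n+1) w_n
fibWord : ℕ → List Letter
fibWord zero          = A ∷ []
fibWord (suc zero)    = A ∷ B ∷ []
fibWord (suc (suc k)) = fibWord (suc k) ++ fibWord k

-- k-th letter (0-indexed) of a list, with default A (never used below)
letterAt : List Letter → ℕ → Letter
letterAt []       _       = A
letterAt (x ∷ _)  zero    = x
letterAt (_ ∷ xs) (suc k) = letterAt xs k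

-- c i (1-indexed) of the infinite Fibonacci word: the i-th letter of
-- w_(i+1) = fibWord i, which has length ≥ i + 1 and is a prefix of all
-- later Fibonacci words.
c : ℕ → Letter
c zero    = A   -- unused (c is indexed from 1)
c (suc i) = letterAt (fibWord (suc i)) i

v : Letter → ℤφ
v A = oneφ
v B = ψ

p : ℕ → ℤφ
p zero    = zeroφ
p (suc m) = p m ⊕ v (c (suc m))

Phinary : ℤφ → Set
Phinary x = ∃[ m ] (1 ≤ m × p m ≡ x)

module Submission where

-- The Fibonacci substitution σ : A ↦ AB, B ↦ A satisfies σ(w_k) = w_(k+1),
-- and since φ·v(A) = φ = 1 + ψ = v(AB) and φ·v(B) = φψ = 1 = v(A), it
-- scales letter sums by φ: vsum (σ u) = φ · vsum u.  Every Fibonacci word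
-- is a prefix of the next one, so p_m is the letter sum of the length-m
-- prefix of any Fibonacci word that is at least m long.  Taking u the
-- length-m prefix of w_m, σ u is a prefix of w_(m+1), hence
-- φ·p_m = vsum (σ u) = p_|σ u| with |σ u| ≥ m ≥ 1.  Iterating gives the
-- theorem for every n.

open import Data.Nat using (ℕ; _≤_)
open import Defs

open import Data.Nat using (zero; suc; z≤n; s≤s; _<_; _≤′_; ≤′-refl; ≤′-step)
open import Data.Nat.Properties as ℕₚ using (≤-trans; ≤⇒≤′; m≤n+m; n≤1+n)
open import Data.Integer using (+_) renaming (_+_ to _+ℤ_; _*_ to _*ℤ_)
open import Data.Integer.Tactic.RingSolver using (solve-∀)
open import Data.List using (List; []; _∷_; _++_; length; take; drop)
open import Data.List.Properties using (length-++; length-++-≤ˡ; length-take; ++-assoc; ++-identityʳ; take++drop≡id)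
open import Data.Sum using (inj₁; inj₂)
open import Data.Product using (_,_; ∃-syntax)
open import Relation.Binary.PropositionalEquality
open ≡-Reasoning

⊕-assoc : ∀ x y z → (x ⊕ y) ⊕ z ≡ x ⊕ (y ⊕ z)
⊕-assoc (a + b φ) (c + d φ) (e + f φ) = cong₂ _+_φ (assoc a c e) (assoc b d f)
  where
  assoc : ∀ a c e → (a +ℤ c) +ℤ e ≡ a +ℤ (c +ℤ e)
  assoc = solve-∀

⊕-identityˡ : ∀ x → zeroφ ⊕ x ≡ x
⊕-identityˡ (a + b φ) = cong₂ _+_φ (identity a) (identity b)
  where
  identity : ∀ a → + 0 +ℤ a ≡ a
  identity = solve-∀

⊕-identityʳ : ∀ x → x ⊕ zeroφ ≡ x
⊕-identityʳ (a + b φ) = cong₂ _+_φ (identity a) (identity b)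
  where
  identity : ∀ a → a +ℤ + 0 ≡ a
  identity = solve-∀

⊗-identityˡ : ∀ x → oneφ ⊗ x ≡ x
⊗-identityˡ (a + b φ) = cong₂ _+_φ (reIdentity a b) (imIdentity a b)
  where
  reIdentity : ∀ a b → (+ 1 *ℤ a) +ℤ (+ 0 *ℤ b) ≡ a
  reIdentity = solve-∀
  imIdentity : ∀ a b → (+ 1 *ℤ b) +ℤ (+ 0 *ℤ a) +ℤ (+ 0 *ℤ b) ≡ b
  imIdentity = solve-∀

⊗-distribˡ-⊕ : ∀ x y z → x ⊗ (y ⊕ z) ≡ (x ⊗ y) ⊕ (x ⊗ z)
⊗-distribˡ-⊕ (a + b φ) (c + d φ) (e + f φ) =
  cong₂ _+_φ (reDistrib a b c d e f) (imDistrib a b c d e f)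
  where
  reDistrib : ∀ a b c d e f →
    (a *ℤ (c +ℤ e)) +ℤ (b *ℤ (d +ℤ f))
      ≡ ((a *ℤ c) +ℤ (b *ℤ d)) +ℤ ((a *ℤ e) +ℤ (b *ℤ f))
  reDistrib = solve-∀
  imDistrib : ∀ a b c d e f →
    (a *ℤ (d +ℤ f)) +ℤ (b *ℤ (c +ℤ e)) +ℤ (b *ℤ (d +ℤ f))
      ≡ ((a *ℤ d) +ℤ (b *ℤ c) +ℤ (b *ℤ d)) +ℤ ((a *ℤ f) +ℤ (b *ℤ e) +ℤ (b *ℤ f))
  imDistrib = solve-∀

⊗-assoc : ∀ x y z → (x ⊗ y) ⊗ z ≡ x ⊗ (y ⊗ z)
⊗-assoc (a + b φ) (c + d φ) (e + f φ) =
  cong₂ _+_φ (reAssoc a b c d e f) (imAssoc a b c d e f)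
  where
  reAssoc : ∀ a b c d e f →
    let r = (a *ℤ c) +ℤ (b *ℤ d); s = (a *ℤ d) +ℤ (b *ℤ c) +ℤ (b *ℤ d)
        t = (c *ℤ e) +ℤ (d *ℤ f); u = (c *ℤ f) +ℤ (d *ℤ e) +ℤ (d *ℤ f)
    in (r *ℤ e) +ℤ (s *ℤ f) ≡ (a *ℤ t) +ℤ (b *ℤ u)
  reAssoc = solve-∀
  imAssoc : ∀ a b c d e f →
    let r = (a *ℤ c) +ℤ (b *ℤ d); s = (a *ℤ d) +ℤ (b *ℤ c) +ℤ (b *ℤ d)
        t = (c *ℤ e) +ℤ (d *ℤ f); u = (c *ℤ f) +ℤ (d *ℤ e) +ℤ (d *ℤ f)
    in (r *ℤ f) +ℤ (s *ℤ e) +ℤ (s *ℤ f) ≡ (a *ℤ u) +ℤ (b *ℤ t) +ℤ (b *ℤ u)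
  imAssoc = solve-∀

φ≡1+ψ : φ ≡ oneφ ⊕ ψ
φ≡1+ψ = refl

φψ≡1 : φ ⊗ ψ ≡ oneφ
φψ≡1 = refl

vsum : List Letter → ℤφ
vsum []      = zeroφ
vsum (x ∷ w) = v x ⊕ vsum w

fibWord-extends : ∀ k → ∃[ r ] fibWord (suc k) ≡ fibWord k ++ r
fibWord-extends zero    = B ∷ [] , refl
fibWord-extends (suc k) = fibWord k , refl

fibWord-prefix : ∀ {j k} → j ≤′ k → ∃[ r ] fibWord k ≡ fibWord j ++ r
fibWord-prefix {j} ≤′-refl = [] , sym (++-identityʳ (fibWord j))
fibWord-prefix {j} (≤′-step {k} j≤k) with fibWord-prefix j≤k | fibWord-extends k
... | r , wₖ≡wⱼr | s , wₖ₊₁≡wₖs = r ++ s , (begin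
  fibWord (suc k)          ≡⟨ wₖ₊₁≡wₖs ⟩
  fibWord k ++ s           ≡⟨ cong (_++ s) wₖ≡wⱼr ⟩
  (fibWord j ++ r) ++ s    ≡⟨ ++-assoc (fibWord j) r s ⟩
  fibWord j ++ (r ++ s)    ∎)

-- w_k has more than k letters, so c_(k+1) really is a letter of w_(k+1).
fibWord-length : ∀ k → suc k ≤ length (fibWord k)
fibWord-length zero          = s≤s z≤n
fibWord-length (suc zero)    = s≤s (s≤s z≤n)
fibWord-length (suc (suc k)) =
  subst (suc (suc (suc k)) ≤_) (sym (length-++ (fibWord (suc k))))
    (≤-trans (s≤s (s≤s (m≤n+m (suc k) k)))
             (ℕₚ.+-mono-≤ (fibWord-length (suc k)) (fibWord-length k)))

letterAt-++ : ∀ u r {i} → i < length u → letterAt (u ++ r) i ≡ letterAt u i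
letterAt-++ (x ∷ u) r {zero}  _         = refl
letterAt-++ (x ∷ u) r {suc i} (s≤s i<u) = letterAt-++ u r i<u

fibWord-letter-stable : ∀ {j k i} → j ≤ k → i < length (fibWord j) →
                        letterAt (fibWord k) i ≡ letterAt (fibWord j) i
fibWord-letter-stable {j} j≤k i<wⱼ with fibWord-prefix (≤⇒≤′ j≤k)
... | r , wₖ≡wⱼr = trans (cong (λ w → letterAt w _) wₖ≡wⱼr) (letterAt-++ (fibWord j) r i<wⱼ)

fibWord-letter : ∀ k {i} → i < length (fibWord k) → letterAt (fibWord k) i ≡ c (suc i)
fibWord-letter k {i} i<wₖ with ℕₚ.≤-total k (suc i)
... | inj₁ k≤1+i = sym (fibWord-letter-stable k≤1+i i<wₖ)
... | inj₂ 1+i≤k = fibWord-letter-stable 1+i≤k (≤-trans (n≤1+n (suc i)) (fibWord-length (suc i)))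

vsum-take-suc : ∀ w {m} → m < length w →
                vsum (take (suc m) w) ≡ vsum (take m w) ⊕ v (letterAt w m)
vsum-take-suc (x ∷ w) {zero}  _ = trans (⊕-identityʳ (v x)) (sym (⊕-identityˡ (v x)))
vsum-take-suc (x ∷ w) {suc m} (s≤s m<w) =
  trans (cong (v x ⊕_) (vsum-take-suc w m<w)) (sym (⊕-assoc (v x) _ _))

p≡vsum-take : ∀ k {m} → m ≤ length (fibWord k) → p m ≡ vsum (take m (fibWord k))
p≡vsum-take k {zero}  _       = refl
p≡vsum-take k {suc m} 1+m≤wₖ = begin
  p m ⊕ v (c (suc m))
    ≡⟨ cong₂ _⊕_ (p≡vsum-take k (≤-trans (n≤1+n m) 1+m≤wₖ))
                 (cong v (sym (fibWord-letter k 1+m≤wₖ))) ⟩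
  vsum (take m (fibWord k)) ⊕ v (letterAt (fibWord k) m)
    ≡⟨ sym (vsum-take-suc (fibWord k) 1+m≤wₖ) ⟩
  vsum (take (suc m) (fibWord k)) ∎

take-length-++ : ∀ {X : Set} (u r : List X) → take (length u) (u ++ r) ≡ u
take-length-++ []      r = refl
take-length-++ (x ∷ u) r = cong (x ∷_) (take-length-++ u r)

p≡vsum-prefix : ∀ k u r → fibWord k ≡ u ++ r → p (length u) ≡ vsum u
p≡vsum-prefix k u r wₖ≡ur = begin
  p (length u)                          ≡⟨ p≡vsum-take k |u|≤|wₖ| ⟩
  vsum (take (length u) (fibWord k))    ≡⟨ cong (λ w → vsum (take (length u) w)) wₖ≡ur ⟩
  vsum (take (length u) (u ++ r))       ≡⟨ cong vsum (take-length-++ u r) ⟩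
  vsum u                                ∎
  where
  |u|≤|wₖ| : length u ≤ length (fibWord k)
  |u|≤|wₖ| = subst (λ w → length u ≤ length w) (sym wₖ≡ur) (length-++-≤ˡ u)

σ : List Letter → List Letter
σ []      = []
σ (A ∷ w) = A ∷ B ∷ σ w
σ (B ∷ w) = A ∷ σ w

σ-++ : ∀ u r → σ (u ++ r) ≡ σ u ++ σ r
σ-++ []      r = refl
σ-++ (A ∷ u) r = cong (λ w → A ∷ B ∷ w) (σ-++ u r)
σ-++ (B ∷ u) r = cong (A ∷_) (σ-++ u r)

σ-length : ∀ u → length u ≤ length (σ u)
σ-length []      = z≤n
σ-length (A ∷ u) = s≤s (ℕₚ.m≤n⇒m≤1+n (σ-length u))
σ-length (B ∷ u) = s≤s (σ-length u)

fibWord-σ : ∀ k → fibWord (suc k) ≡ σ (fibWord k)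
fibWord-σ zero          = refl
fibWord-σ (suc zero)    = refl
fibWord-σ (suc (suc k)) = begin
  fibWord (suc (suc k)) ++ fibWord (suc k)    ≡⟨ cong₂ _++_ (fibWord-σ (suc k)) (fibWord-σ k) ⟩
  σ (fibWord (suc k)) ++ σ (fibWord k)        ≡⟨ sym (σ-++ (fibWord (suc k)) (fibWord k)) ⟩
  σ (fibWord (suc k) ++ fibWord k)            ∎

-- σ multiplies letter sums by φ, because φ·1 = 1 + ψ and φ·ψ = 1.
vsum-σ : ∀ u → vsum (σ u) ≡ φ ⊗ vsum u
vsum-σ []      = refl
vsum-σ (A ∷ u) = begin
  oneφ ⊕ (ψ ⊕ vsum (σ u))    ≡⟨ sym (⊕-assoc oneφ ψ (vsum (σ u))) ⟩
  (oneφ ⊕ ψ) ⊕ vsum (σ u)    ≡⟨ cong₂ _⊕_ (sym φ≡1+ψ) (vsum-σ u) ⟩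
  φ ⊕ φ ⊗ vsum u             ≡⟨ sym (⊗-distribˡ-⊕ φ oneφ (vsum u)) ⟩
  φ ⊗ (oneφ ⊕ vsum u)        ∎
vsum-σ (B ∷ u) = begin
  oneφ ⊕ vsum (σ u)          ≡⟨ cong₂ _⊕_ (sym φψ≡1) (vsum-σ u) ⟩
  φ ⊗ ψ ⊕ φ ⊗ vsum u         ≡⟨ sym (⊗-distribˡ-⊕ φ ψ (vsum u)) ⟩
  φ ⊗ (ψ ⊕ vsum u)           ∎

-- φ·p_m = p_|σ u| for u the length-m prefix of w_m, as σ u is a prefix of w_(m+1).
φ-preserves-Phinary : ∀ x → Phinary x → Phinary (φ ⊗ x)
φ-preserves-Phinary x (m , 1≤m , refl) = length (σ u) , 1≤|σu| , φpₘ
  where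
  u r : List Letter
  u = take m (fibWord m)
  r = drop m (fibWord m)

  m≤|wₘ| : m ≤ length (fibWord m)
  m≤|wₘ| = ≤-trans (n≤1+n m) (fibWord-length m)

  |u|≡m : length u ≡ m
  |u|≡m = trans (length-take m (fibWord m)) (ℕₚ.m≤n⇒m⊓n≡m m≤|wₘ|)

  wₘ≡ur : fibWord m ≡ u ++ r
  wₘ≡ur = sym (take++drop≡id m (fibWord m))

  wₘ₊₁≡σuσr : fibWord (suc m) ≡ σ u ++ σ r
  wₘ₊₁≡σuσr = trans (fibWord-σ m) (trans (cong σ wₘ≡ur) (σ-++ u r))

  1≤|σu| : 1 ≤ length (σ u)
  1≤|σu| = ≤-trans 1≤m (subst (_≤ length (σ u)) |u|≡m (σ-length u))

  φpₘ : p (length (σ u)) ≡ φ ⊗ p m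
  φpₘ = begin
    p (length (σ u))     ≡⟨ p≡vsum-prefix (suc m) (σ u) (σ r) wₘ₊₁≡σuσr ⟩
    vsum (σ u)           ≡⟨ vsum-σ u ⟩
    φ ⊗ vsum u           ≡⟨ cong (φ ⊗_) (sym (p≡vsum-prefix m u r wₘ≡ur)) ⟩
    φ ⊗ p (length u)     ≡⟨ cong (λ n → φ ⊗ p n) |u|≡m ⟩
    φ ⊗ p m              ∎

φ^-preserves-Phinary : ∀ x → Phinary x → ∀ n → Phinary (φ^ n ⊗ x)
φ^-preserves-Phinary x px zero    = subst Phinary (sym (⊗-identityˡ x)) px
φ^-preserves-Phinary x px (suc n) =
  subst Phinary (sym (⊗-assoc φ (φ^ n) x)) (φ-preserves-Phinary _ (φ^-preserves-Phinary x px n))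

mainTheorem9 : (x : ℤφ) → Phinary x → (n : ℕ) → 1 ≤ n → Phinary (φ^ n ⊗ x)
mainTheorem9 x px n _ = φ^-preserves-Phinary x px n
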